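{- Let $G$ be a finite simple subcubic graph. Let $B$ be a spanning bipartite subgraph of $G$ with bipartition $V(G)=X\cup Y$ (every edge of $B$ joins a vertex of $X$ to a vertex of $Y$) such that $B$ has the maximum number of edges among all spanning bipartite subgraphs of $G$. Call a vertex bad if it is an end of an edge of $G[X]$ or of an edge of $G[Y]$. If $x\in X$ and $y\in Y$ are two adjacent bad vertices, then $d_G(x)=d_G(y)=3$.
   Context: A subcubic graph is a graph in which every vertex has at most three neighbors. A spanning subgraph of $G$ is a subgraph $H$ with $V(H)=V(G)$. $G[S]$ denotes the subgraph of $G$ induced by $S\subseteq V(G)$, and $d_G(v)$ is the degree of $v$ in $G$. -}

module Defs where

open import Data.Nat using (ℕ; _≤_)
open import Data.Fin using (Fin; _<?_)
open import Data.Fin.Base using (_<_)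
open import Data.Bool using (Bool)
open import Data.List using (List; length; filter; cartesianProduct; allFin)
open import Data.Product using (Σ; ∃; _×_; _,_; proj₁; proj₂)
open import Relation.Nullary using (¬_; Dec)
open import Relation.Nullary.Decidable using (_×-dec_)
open import Relation.Binary.PropositionalEquality using (_≡_; _≢_)

record Graph (n : ℕ) : Set₁ where
  field
    Adj    : Fin n → Fin n → Set
    adj?   : ∀ i j → Dec (Adj i j)
    sym    : ∀ {i j} → Adj i j → Adj j i
    irrefl : ∀ {i} → ¬ Adj i i
open Graph public

degree : ∀ {n} → Graph n → Fin n → ℕ
degree G v = length (filter (adj? G v) (allFin _))

edgeCount : ∀ {n} → Graph n → ℕ
edgeCount {n} G =
  length (filter (λ p → (proj₁ p <? proj₂ p) ×-dec adj? G (proj₁ p) (proj₂ p))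
                 (cartesianProduct (allFin n) (allFin n)))

Subcubic : ∀ {n} → Graph n → Set
Subcubic G = ∀ v → degree G v ≤ 3

SpanningSubgraph : ∀ {n} → Graph n → Graph n → Set
SpanningSubgraph H G = ∀ i j → Adj H i j → Adj G i j

-- side : Fin n → Bool is a bipartition V = X ∪ Y with X = side⁻¹(true), Y = side⁻¹(false);
-- every edge of H joins X to Y.
IsBipartition : ∀ {n} → Graph n → (Fin n → Bool) → Set
IsBipartition H side = ∀ i j → Adj H i j → side i ≢ side j

Bipartite : ∀ {n} → Graph n → Set
Bipartite {n} H = ∃ λ (side : Fin n → Bool) → IsBipartition H side

-- v is bad: v is an end of an edge of G[X] or of G[Y], i.e. v has a G-neighbour on its own side.
Bad : ∀ {n} → Graph n → (Fin n → Bool) → Fin n → Set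
Bad G side v = ∃ λ w → Adj G v w × side v ≡ side w

-- The bipartition of a maximum bipartite spanning subgraph is a maximum cut of G. Let xy be a
-- cut edge with x and y bad, witnessed by monochromatic edges xw and yu, and suppose d(x) ≤ 2, so
-- that N(x) = {y, w}. Moving both x and y to the other side keeps xy in the cut and adds xw and
-- yu to it; the only cut edge that can be lost joins y to its third neighbour, since x has no
-- cut edge other than xy. The cut grows, a contradiction; by symmetry also d(y) = 3.
module Submission where

open import Defs renaming (sym to Adj-sym)
open import Data.Nat using (ℕ; suc; _+_; _≤_; _<_; z≤n; s≤s; _≤?_)
open import Data.Nat.Properties using (≤-antisym; ≰⇒>; <⇒≱; +-monoʳ-<; +-suc; +-cancelʳ-<; ≤-trans; <-≤-trans)
open import Data.Fin using (Fin; zero; suc; _≟_; _<?_)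
import Data.Fin as Fin
open import Data.Fin.Properties using (injective⇒≤; <-cmp; <-asym)
open import Data.Bool using (Bool; true; false; not; if_then_else_)
import Data.Bool as Bool
open import Data.Bool.Properties using (not-¬; not-injective)
open import Data.List using (List; []; _∷_; length; lookup; filter; cartesianProduct; allFin)
open import Data.List.Membership.Propositional using (_∈_)
open import Data.List.Membership.Propositional.Properties using (∈-lookup; ∈-filter⁺; ∈-filter⁻; ∈-allFin; ∈-cartesianProduct⁺)
open import Data.List.Membership.Setoid.Properties using (index-injective)
open import Data.List.Relation.Unary.Any using (here; there; index)
open import Data.List.Relation.Unary.All as All using (All; []; _∷_)
open import Data.List.Relation.Unary.AllPairs using ([]; _∷_)
open import Data.List.Relation.Unary.Unique.Propositional using (Unique)
import Data.List.Relation.Unary.Unique.Propositional.Properties as Unique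
import Data.List.Relation.Binary.Sublist.Propositional as Sublist
import Data.List.Relation.Binary.Sublist.Propositional.Properties as Sublist
open import Data.Product using (∃; _×_; _,_; proj₁; proj₂)
open import Data.Sum using (_⊎_; inj₁; inj₂; [_,_])
open import Data.Empty using (⊥-elim)
open import Function using (_∘_)
open import Relation.Nullary using (¬_; yes; no; ¬?; does)
open import Relation.Nullary.Decidable using (_×-dec_; _⊎-dec_; dec-true; dec-false; decidable-stable)
open import Relation.Unary using (Decidable)
open import Relation.Binary using (tri<; tri≈; tri>)
open import Relation.Binary.PropositionalEquality using (_≡_; _≢_; refl; sym; trans; cong; subst; setoid)

module _ {A : Set} where

  lookup-injective : ∀ {xs : List A} → Unique xs → ∀ {i j} → lookup xs i ≡ lookup xs j → i ≡ j
  lookup-injective (_ ∷ _) {zero} {zero} _ = refl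
  lookup-injective (x∉ ∷ _) {zero} {suc j} eq = ⊥-elim (All.lookup x∉ (∈-lookup j) eq)
  lookup-injective (x∉ ∷ _) {suc i} {zero} eq = ⊥-elim (All.lookup x∉ (∈-lookup i) (sym eq))
  lookup-injective (_ ∷ u) {suc i} {suc j} eq = cong suc (lookup-injective u eq)

  Unique-⊆⇒length≤ : ∀ {ys xs : List A} → Unique ys → (∀ {a} → a ∈ ys → a ∈ xs) →
    length ys ≤ length xs
  Unique-⊆⇒length≤ u ys⊆xs = injective⇒≤ {f = index ∘ ys⊆xs ∘ ∈-lookup} λ eq →
    lookup-injective u (index-injective (setoid A) (ys⊆xs (∈-lookup _)) (ys⊆xs (∈-lookup _)) eq)

  Unique-constant⇒length≤1 : ∀ {xs : List A} → Unique xs → (∀ {a b} → a ∈ xs → b ∈ xs → a ≡ b) →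
    length xs ≤ 1
  Unique-constant⇒length≤1 {[]} _ _ = z≤n
  Unique-constant⇒length≤1 {_ ∷ []} _ _ = s≤s z≤n
  Unique-constant⇒length≤1 {_ ∷ _ ∷ _} ((a≢b ∷ _) ∷ _) const =
    ⊥-elim (a≢b (const (here refl) (there (here refl))))

  length-filter-mono : ∀ {P Q : A → Set} (P? : Decidable P) (Q? : Decidable Q) →
    (∀ {a} → P a → Q a) → (xs : List A) → length (filter P? xs) ≤ length (filter Q? xs)
  length-filter-mono P? Q? P⇒Q xs =
    Sublist.length-mono-≤ (Sublist.filter⁺ P? Q? (λ { refl → P⇒Q }) (Sublist.⊆-refl {x = xs}))

  length-filter-+-difference : ∀ {P Q : A → Set} (P? : Decidable P) (Q? : Decidable Q) (xs : List A) →
    length (filter P? xs) + length (filter (λ a → Q? a ×-dec ¬? (P? a)) xs)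
      ≡ length (filter Q? xs) + length (filter (λ a → P? a ×-dec ¬? (Q? a)) xs)
  length-filter-+-difference P? Q? [] = refl
  length-filter-+-difference P? Q? (a ∷ xs) with P? a | Q? a | length-filter-+-difference P? Q? xs
  ... | yes _ | yes _ | ih = cong suc ih
  ... | yes _ | no _ | ih = trans (cong suc ih) (sym (+-suc _ _))
  ... | no _ | yes _ | ih = trans (+-suc _ _) (cong suc ih)
  ... | no _ | no _ | ih = ih

module _ {n : ℕ} where

  distinct-neighbours⇒≤degree : (G : Graph n) {v : Fin n} {ys : List (Fin n)} →
    Unique ys → All (Adj G v) ys → length ys ≤ degree G v
  distinct-neighbours⇒≤degree G {v} u adj =
    Unique-⊆⇒length≤ u λ k∈ys → ∈-filter⁺ (adj? G v) (∈-allFin _) (All.lookup adj k∈ys)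

  pairs : List (Fin n × Fin n)
  pairs = cartesianProduct (allFin n) (allFin n)

  ∈pairs : ∀ i j → (i , j) ∈ pairs
  ∈pairs i j = ∈-cartesianProduct⁺ (∈-allFin i) (∈-allFin j)

  pairs-Unique : Unique pairs
  pairs-Unique = Unique.cartesianProduct⁺ (Unique.allFin⁺ n) (Unique.allFin⁺ n)

  IsEdge : Graph n → Fin n × Fin n → Set
  IsEdge H p = proj₁ p Fin.< proj₂ p × Adj H (proj₁ p) (proj₂ p)

  isEdge? : (H : Graph n) → Decidable (IsEdge H)
  isEdge? H p = (proj₁ p <? proj₂ p) ×-dec adj? H (proj₁ p) (proj₂ p)

  IsNewEdge : Graph n → Graph n → Fin n × Fin n → Set
  IsNewEdge H K p = IsEdge K p × ¬ IsEdge H p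

  isNewEdge? : (H K : Graph n) → Decidable (IsNewEdge H K)
  isNewEdge? H K p = isEdge? K p ×-dec ¬? (isEdge? H p)

  newEdges : Graph n → Graph n → List (Fin n × Fin n)
  newEdges H K = filter (isNewEdge? H K) pairs

  newEdges-Unique : (H K : Graph n) → Unique (newEdges H K)
  newEdges-Unique H K = Unique.filter⁺ (isNewEdge? H K) pairs-Unique

  ∈newEdges : (H K : Graph n) {i j : Fin n} → i ≢ j → Adj K i j → ¬ Adj H i j →
    ∃ λ p → p ∈ newEdges H K × (p ≡ (i , j) ⊎ p ≡ (j , i))
  ∈newEdges H K {i} {j} i≢j i~j i≁j with <-cmp i j
  ... | tri< i<j _ _ =
    (i , j) , ∈-filter⁺ (isNewEdge? H K) (∈pairs i j) ((i<j , i~j) , i≁j ∘ proj₂) , inj₁ refl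
  ... | tri≈ _ i≡j _ = ⊥-elim (i≢j i≡j)
  ... | tri> _ _ j<i =
    (j , i) , ∈-filter⁺ (isNewEdge? H K) (∈pairs j i) ((j<i , Adj-sym K i~j) , i≁j ∘ Adj-sym H ∘ proj₂)
    , inj₂ refl

  edgeCount-mono : {H K : Graph n} → SpanningSubgraph H K → edgeCount H ≤ edgeCount K
  edgeCount-mono {H} {K} H⊆K =
    length-filter-mono (isEdge? H) (isEdge? K) (λ (i<j , i~j) → i<j , H⊆K _ _ i~j) pairs

  edgeCount-<-newEdges : (H K : Graph n) → length (newEdges K H) < length (newEdges H K) →
    edgeCount H < edgeCount K
  edgeCount-<-newEdges H K lost<gained = +-cancelʳ-< _ (edgeCount H) (edgeCount K)
    (subst (_< edgeCount K + length (newEdges H K))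
           (sym (length-filter-+-difference (isEdge? H) (isEdge? K) pairs))
           (+-monoʳ-< (edgeCount K) lost<gained))

  Cut : Graph n → (Fin n → Bool) → Graph n
  Cut G side = record
    { Adj = λ i j → Adj G i j × side i ≢ side j
    ; adj? = λ i j → adj? G i j ×-dec ¬? (side i Bool.≟ side j)
    ; sym = λ (i~j , i↔j) → Adj-sym G i~j , i↔j ∘ sym
    ; irrefl = irrefl G ∘ proj₁
    }

  bipartite⊆Cut : {G B : Graph n} {side : Fin n → Bool} →
    SpanningSubgraph B G → IsBipartition B side → SpanningSubgraph B (Cut G side)
  bipartite⊆Cut B⊆G bip i j i~j = B⊆G i j i~j , bip i j i~j

  flipAt : Fin n → (Fin n → Bool) → Fin n → Bool
  flipAt x side v = if does (v ≟ x) then not (side v) else side v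

  flipAt-here : (x : Fin n) (side : Fin n → Bool) → flipAt x side x ≡ not (side x)
  flipAt-here x side rewrite dec-true (x ≟ x) refl = refl

  flipAt-there : {x v : Fin n} (side : Fin n → Bool) → v ≢ x → flipAt x side v ≡ side v
  flipAt-there {x} {v} side v≢x rewrite dec-false (v ≟ x) v≢x = refl

  maximum-bipartite⇒maximum-cut : (G B : Graph n) {side : Fin n → Bool} →
    SpanningSubgraph B G → IsBipartition B side →
    (∀ (B′ : Graph n) → SpanningSubgraph B′ G → Bipartite B′ → edgeCount B′ ≤ edgeCount B) →
    ∀ side′ → edgeCount (Cut G side′) ≤ edgeCount (Cut G side)
  maximum-bipartite⇒maximum-cut G B {side} B⊆G bip maximum side′ =
    ≤-trans (maximum (Cut G side′) (λ _ _ → proj₁) (side′ , λ _ _ (_ , i↔j) → i↔j))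
            (edgeCount-mono {B} {Cut G side} (bipartite⊆Cut {G} {B} B⊆G bip))

module Switching {n : ℕ} (G : Graph n) (side : Fin n → Bool) {x y w u : Fin n}
  (x~y : Adj G x y) (side-xy : side x ≢ side y)
  (x~w : Adj G x w) (side-xw : side x ≡ side w)
  (y~u : Adj G y u) (side-yu : side y ≡ side u)
  (deg-x : degree G x ≤ 2) (deg-y : degree G y ≤ 3) where

  side′ : Fin n → Bool
  side′ = flipAt x (flipAt y side)

  cut cut′ : Graph n
  cut = Cut G side
  cut′ = Cut G side′

  Switched : Fin n → Set
  Switched v = v ≡ x ⊎ v ≡ y

  switched? : Decidable Switched
  switched? v = (v ≟ x) ⊎-dec (v ≟ y)

  x≢y : x ≢ y
  x≢y = side-xy ∘ cong side

  w≢x : w ≢ x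
  w≢x refl = irrefl G x~w

  w≢y : w ≢ y
  w≢y refl = side-xy side-xw

  u≢x : u ≢ x
  u≢x refl = side-xy (sym side-yu)

  u≢y : u ≢ y
  u≢y refl = irrefl G y~u

  side′-switched : ∀ {v} → Switched v → side′ v ≡ not (side v)
  side′-switched (inj₁ refl) =
    trans (flipAt-here x (flipAt y side)) (cong not (flipAt-there side x≢y))
  side′-switched (inj₂ refl) =
    trans (flipAt-there (flipAt y side) (x≢y ∘ sym)) (flipAt-here y side)

  side′-unswitched : ∀ {v} → ¬ Switched v → side′ v ≡ side v
  side′-unswitched v∉ =
    trans (flipAt-there (flipAt y side) (v∉ ∘ inj₁)) (flipAt-there side (v∉ ∘ inj₂))

  crossing-neighbour-of-x : ∀ {j} → Adj G x j → side x ≢ side j → j ≡ y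
  crossing-neighbour-of-x {j} x~j side-xj with j ≟ y
  ... | yes j≡y = j≡y
  ... | no j≢y =
    ⊥-elim (<⇒≱ (s≤s deg-x) (distinct-neighbours⇒≤degree G distinct (x~y ∷ x~w ∷ x~j ∷ [])))
    where
    w≢j : w ≢ j
    w≢j refl = side-xj side-xw

    distinct : Unique (y ∷ w ∷ j ∷ [])
    distinct = ((w≢y ∘ sym) ∷ (j≢y ∘ sym) ∷ []) ∷ (w≢j ∷ []) ∷ [] ∷ []

  CrossingNeighbourOfY : Fin n → Set
  CrossingNeighbourOfY k = Adj G y k × k ≢ x × side y ≢ side k

  crossing-neighbour-of-y-unique : ∀ {k k′} →
    CrossingNeighbourOfY k → CrossingNeighbourOfY k′ → k ≡ k′
  crossing-neighbour-of-y-unique {k} {k′} (y~k , k≢x , side-yk) (y~k′ , k′≢x , side-yk′)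
    with k ≟ k′
  ... | yes k≡k′ = k≡k′
  ... | no k≢k′ = ⊥-elim (<⇒≱ (s≤s deg-y)
                    (distinct-neighbours⇒≤degree G distinct (Adj-sym G x~y ∷ y~u ∷ y~k ∷ y~k′ ∷ [])))
    where
    u≢k : ∀ {k} → side y ≢ side k → u ≢ k
    u≢k side-yk refl = side-yk side-yu

    distinct : Unique (x ∷ u ∷ k ∷ k′ ∷ [])
    distinct = ((u≢x ∘ sym) ∷ (k≢x ∘ sym) ∷ (k′≢x ∘ sym) ∷ [])
             ∷ (u≢k side-yk ∷ u≢k side-yk′ ∷ []) ∷ (k≢k′ ∷ []) ∷ [] ∷ []

  crossing-edge-leaving-switched : ∀ {i j} → Switched i → ¬ Switched j →
    Adj G i j → side i ≢ side j → i ≡ y × CrossingNeighbourOfY j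
  crossing-edge-leaving-switched (inj₁ refl) j∉ x~j side-xj =
    ⊥-elim (j∉ (inj₂ (crossing-neighbour-of-x x~j side-xj)))
  crossing-edge-leaving-switched (inj₂ refl) j∉ y~j side-yj = refl , y~j , j∉ ∘ inj₁ , side-yj

  lost-edge : ∀ {i j} → Adj G i j → side i ≢ side j → side′ i ≡ side′ j →
    (i ≡ y × CrossingNeighbourOfY j) ⊎ (j ≡ y × CrossingNeighbourOfY i)
  lost-edge {i} {j} i~j side-ij side′-ij with switched? i | switched? j
  ... | yes i∈ | yes j∈ =
    ⊥-elim (side-ij (not-injective
      (trans (sym (side′-switched i∈)) (trans side′-ij (side′-switched j∈)))))
  ... | no i∉ | no j∉ =
    ⊥-elim (side-ij (trans (sym (side′-unswitched i∉)) (trans side′-ij (side′-unswitched j∉))))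
  ... | yes i∈ | no j∉ = inj₁ (crossing-edge-leaving-switched i∈ j∉ i~j side-ij)
  ... | no i∉ | yes j∈ = inj₂ (crossing-edge-leaving-switched j∈ i∉ (Adj-sym G i~j) (side-ij ∘ sym))

  gained-edge : ∀ {i j} → Switched i → ¬ Switched j → Adj G i j → side i ≡ side j →
    Adj cut′ i j × ¬ Adj cut i j
  gained-edge i∈ j∉ i~j side-ij =
    (i~j , λ side′-ij → not-¬ (sym side-ij)
                          (trans (sym (side′-unswitched j∉)) (trans (sym side′-ij) (side′-switched i∈))))
    , λ (_ , side-ij′) → side-ij′ side-ij

  two-gained : 2 ≤ length (newEdges cut cut′)
  two-gained with gained-edge (inj₁ refl) [ w≢x , w≢y ] x~w side-xw
                | gained-edge (inj₂ refl) [ u≢x , u≢y ] y~u side-yu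
  ... | xw-cut , xw-uncut | yu-cut , yu-uncut
    with ∈newEdges cut cut′ (w≢x ∘ sym) xw-cut xw-uncut
       | ∈newEdges cut cut′ (u≢y ∘ sym) yu-cut yu-uncut
  ... | p , p∈ , p≡ | q , q∈ , q≡ =
    Unique-⊆⇒length≤ ((distinct p≡ q≡ ∷ []) ∷ [] ∷ [])
                     λ { (here refl) → p∈ ; (there (here refl)) → q∈ }
    where
    distinct : ∀ {p q} → p ≡ (x , w) ⊎ p ≡ (w , x) → q ≡ (y , u) ⊎ q ≡ (u , y) → p ≢ q
    distinct (inj₁ refl) (inj₁ refl) = x≢y ∘ cong proj₁
    distinct (inj₁ refl) (inj₂ refl) = u≢x ∘ sym ∘ cong proj₁
    distinct (inj₂ refl) (inj₁ refl) = u≢x ∘ sym ∘ cong proj₂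
    distinct (inj₂ refl) (inj₂ refl) = x≢y ∘ cong proj₂

  lost-pair : ∀ {p} → p ∈ newEdges cut′ cut →
    proj₁ p Fin.< proj₂ p ×
    ((proj₁ p ≡ y × CrossingNeighbourOfY (proj₂ p)) ⊎ (proj₂ p ≡ y × CrossingNeighbourOfY (proj₁ p)))
  lost-pair {i , j} p∈ with proj₂ (∈-filter⁻ (isNewEdge? cut′ cut) {xs = pairs} p∈)
  ... | (i<j , i~j , side-ij) , uncut′ =
    i<j , lost-edge i~j side-ij
                    (decidable-stable (side′ i Bool.≟ side′ j) λ side′-ij → uncut′ (i<j , i~j , side′-ij))

  at-most-one-lost : length (newEdges cut′ cut) ≤ 1
  at-most-one-lost = Unique-constant⇒length≤1 (newEdges-Unique cut′ cut) same
    where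
    unique : ∀ {k k′} → CrossingNeighbourOfY k → CrossingNeighbourOfY k′ → k ≡ k′
    unique = crossing-neighbour-of-y-unique

    same : ∀ {p q} → p ∈ newEdges cut′ cut → q ∈ newEdges cut′ cut → p ≡ q
    same p∈ q∈ with lost-pair p∈ | lost-pair q∈
    ... | _ , inj₁ (refl , k) | _ , inj₁ (refl , k′) = cong (y ,_) (unique k k′)
    ... | _ , inj₂ (refl , k) | _ , inj₂ (refl , k′) = cong (_, y) (unique k k′)
    ... | y<k , inj₁ (refl , k) | k′<y , inj₂ (refl , k′) =
      ⊥-elim (<-asym y<k (subst (Fin._< y) (sym (unique k k′)) k′<y))
    ... | k<y , inj₂ (refl , k) | y<k′ , inj₁ (refl , k′) =
      ⊥-elim (<-asym k<y (subst (y Fin.<_) (sym (unique k k′)) y<k′))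

  switching-enlarges-cut : edgeCount cut < edgeCount cut′
  switching-enlarges-cut =
    edgeCount-<-newEdges cut cut′ (<-≤-trans (s≤s at-most-one-lost) two-gained)

maximum-cut-bad-edge⇒degree≡3 : ∀ {n} (G : Graph n) → Subcubic G → (side : Fin n → Bool) →
  (∀ side′ → edgeCount (Cut G side′) ≤ edgeCount (Cut G side)) →
  ∀ {x y} → side x ≢ side y → Adj G x y → Bad G side x → Bad G side y → degree G x ≡ 3
maximum-cut-bad-edge⇒degree≡3 G subcubic side maximum {x} {y} side-xy x~y
                              (w , x~w , side-xw) (u , y~u , side-yu) with degree G x ≤? 2
... | no deg-x≰2 = ≤-antisym (subcubic x) (≰⇒> deg-x≰2)
... | yes deg-x≤2 = ⊥-elim (<⇒≱ switching-enlarges-cut (maximum side′))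
  where open Switching G side x~y side-xy x~w side-xw y~u side-yu deg-x≤2 (subcubic y)

lemma1 : (n : ℕ) (G : Graph n) → Subcubic G →
         (B : Graph n) → SpanningSubgraph B G →
         (side : Fin n → Bool) → IsBipartition B side →
         (∀ (B′ : Graph n) → SpanningSubgraph B′ G → Bipartite B′ → edgeCount B′ ≤ edgeCount B) →
         (x y : Fin n) → side x ≡ true → side y ≡ false → Adj G x y →
         Bad G side x → Bad G side y →
         degree G x ≡ 3 × degree G y ≡ 3
lemma1 n G subcubic B B⊆G side bip maximum x y side-x side-y x~y bad-x bad-y =
  degree≡3 side-xy x~y bad-x bad-y , degree≡3 (side-xy ∘ sym) (Adj-sym G x~y) bad-y bad-x
  where
  degree≡3 : ∀ {x y} → side x ≢ side y → Adj G x y → Bad G side x → Bad G side y → degree G x ≡ 3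
  degree≡3 = maximum-cut-bad-edge⇒degree≡3 G subcubic side
               (maximum-bipartite⇒maximum-cut G B B⊆G bip maximum)

  side-xy : side x ≢ side y
  side-xy side-x≡side-y with trans (sym side-x) (trans side-x≡side-y side-y)
  ... | ()
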